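{- Let $N\geq 2$ be an integer and let $A$ be a matrix over $\mathbb{Z}/N\mathbb{Z}$ whose entries are primitive (i.e. generate the unit ideal of $\mathbb{Z}/N\mathbb{Z}$). Then there exists a $\mathbb{Z}/N\mathbb{Z}$-linear combination of the columns of $A$ whose entries are primitive. In particular, for all $n,m\geq 1$ and every $A\in M_{n,m}(\mathbb{Z}/N\mathbb{Z})$ with strong rank $1$ and primitive entries, some linear combination of the columns of $A$ has primitive entries.
   Context: A finite collection of elements of a commutative ring $R$ is primitive if it generates the unit ideal. For $A\in M_{n,m}(R)$ and $1\leq t\leq\min\{n,m\}$, $I_t(A)$ is the ideal generated by the $t\times t$ minors of $A$; $I_0(A)=R$ and $I_t(A)=(0)$ for $t>\min\{n,m\}$. The strong rank of $A$ is $\max\{t\geq 0: I_t(A)\neq(0)\}$. -}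

module Defs where

open import Data.Nat using (ℕ; zero; suc)
open import Data.Integer using (ℤ; +_; _+_; _*_; _-_)
open import Data.Integer.Divisibility using (_∣_)
open import Data.Fin using (Fin; zero; suc)
open import Data.Product using (∃)

-- Elements of ℤ/Nℤ are represented by integer representatives;
-- equality in ℤ/Nℤ is congruence modulo N.
_≡_[mod_] : ℤ → ℤ → ℕ → Set
a ≡ b [mod N ] = (+ N) ∣ (a - b)

Σ : (k : ℕ) → (Fin k → ℤ) → ℤ
Σ zero    f = + 0
Σ (suc k) f = f zero + Σ k (λ i → f (suc i))

Primitive : (N k : ℕ) → (Fin k → ℤ) → Set
Primitive N k v = ∃ λ (c : Fin k → ℤ) → Σ k (λ i → c i * v i) ≡ + 1 [mod N ]

PrimitiveEntries : (N n m : ℕ) → (Fin n → Fin m → ℤ) → Set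
PrimitiveEntries N n m A =
  ∃ λ (c : Fin n → Fin m → ℤ) →
    Σ n (λ i → Σ m (λ j → c i j * A i j)) ≡ + 1 [mod N ]

colComb : (n m : ℕ) → (Fin n → Fin m → ℤ) → (Fin m → ℤ) → (Fin n → ℤ)
colComb n m A x i = Σ m (λ j → x j * A i j)

{-# OPTIONS --safe #-}
-- Work one prime at a time.  Modulo a prime q some entry A i j is a unit, so column j is
-- primitive mod q.  Being primitive modulo M and modulo K implies being primitive modulo M K,
-- and if A x is primitive modulo P and A y modulo a prime q, then A (x + t y) is primitive
-- modulo q P for t = 0 or t = P.  Induction along the prime factorisation of N concludes.
module Submission where

open import Defs
open import Data.Nat using (ℕ; _≤_; suc)
import Data.Nat.Base as ℕ
import Data.Nat.Divisibility as ℕ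
open import Data.Nat.Coprimality using (Coprime; coprime-Bézout)
open import Data.Nat.GCD using (module Bézout)
open import Data.Nat.Primality using (Prime; prime⇒irreducible; ¬prime[1])
open import Data.Nat.Primality.Factorisation using (factorise; PrimeFactorisation)
open import Data.Nat.ListAction using (product)
open import Data.Nat.ListAction.Properties using (∈⇒∣product)
open import Data.Integer using (ℤ; 0ℤ; 1ℤ; +_; -[1+_]; _+_; _*_; _-_; -_; ∣_∣)
import Data.Integer.Properties as ℤ
open import Data.Integer.Divisibility.Signed
  using (_∣_; divides; ∣ᵤ⇒∣; ∣⇒∣ᵤ; ∣-refl; ∣m∣n⇒∣m+n; ∣m⇒∣-m; ∣n⇒∣m*n)
open import Data.Integer.Tactic.RingSolver using (solve-∀)
open import Data.Fin using (Fin; zero; suc)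
import Data.Fin.Properties as Fin
open import Data.List using (List; []; _∷_)
open import Data.List.Relation.Unary.All as All using (All; []; _∷_)
open import Data.List.Membership.Propositional using (_∈_)
open import Data.Product using (∃; _×_; _,_; proj₁)
open import Data.Sum using (_⊎_; inj₁; inj₂)
open import Relation.Nullary using (¬_; yes; no; ¬?; contradiction)
open import Relation.Nullary.Decidable using (decidable-stable)
open import Relation.Binary.PropositionalEquality
  using (_≡_; refl; sym; trans; cong; cong₂; subst; module ≡-Reasoning)

open ≡-Reasoning

Σ-cong : ∀ k {f g : Fin k → ℤ} → (∀ i → f i ≡ g i) → Σ k f ≡ Σ k g
Σ-cong ℕ.zero    f≡g = refl
Σ-cong (ℕ.suc k) f≡g = cong₂ _+_ (f≡g zero) (Σ-cong k (λ i → f≡g (suc i)))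

Σ-zero : ∀ k → Σ k (λ _ → 0ℤ) ≡ 0ℤ
Σ-zero ℕ.zero    = refl
Σ-zero (ℕ.suc k) = cong (_+_ 0ℤ) (Σ-zero k)

Σ-linear : ∀ k (t : ℤ) (f g : Fin k → ℤ) →
           Σ k (λ i → f i + t * g i) ≡ Σ k f + t * Σ k g
Σ-linear ℕ.zero    t f g = sym (zero-law t)
  where
  zero-law : ∀ t → 0ℤ + t * 0ℤ ≡ 0ℤ
  zero-law = solve-∀
Σ-linear (ℕ.suc k) t f g = begin
  (f zero + t * g zero) + Σ k (λ i → f (suc i) + t * g (suc i))
    ≡⟨ cong (_+_ (f zero + t * g zero)) (Σ-linear k t (f ∘suc) (g ∘suc)) ⟩
  (f zero + t * g zero) + (Σ k (f ∘suc) + t * Σ k (g ∘suc))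
    ≡⟨ regroup (f zero) (g zero) (Σ k (f ∘suc)) (Σ k (g ∘suc)) t ⟩
  (f zero + Σ k (f ∘suc)) + t * (g zero + Σ k (g ∘suc)) ∎
  where
  _∘suc : (Fin (ℕ.suc k) → ℤ) → Fin k → ℤ
  h ∘suc = λ i → h (suc i)
  regroup : ∀ a b c d t → (a + t * b) + (c + t * d) ≡ (a + c) + t * (b + d)
  regroup = solve-∀

δ : ∀ {k} → Fin k → Fin k → ℤ
δ zero    zero    = 1ℤ
δ zero    (suc _) = 0ℤ
δ (suc _) zero    = 0ℤ
δ (suc j) (suc i) = δ j i

Σ-δ : ∀ k (j : Fin k) (f : Fin k → ℤ) → Σ k (λ i → δ j i * f i) ≡ f j
Σ-δ (ℕ.suc k) zero f = begin
  1ℤ * f zero + Σ k (λ i → 0ℤ * f (suc i)) ≡⟨ cong₂ _+_ (ℤ.*-identityˡ (f zero)) (Σ-zero k) ⟩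
  f zero + 0ℤ                              ≡⟨ ℤ.+-identityʳ (f zero) ⟩
  f zero                                   ∎
Σ-δ (ℕ.suc k) (suc j) f = trans (ℤ.+-identityˡ _) (Σ-δ k j (λ i → f (suc i)))

-- A record wrapper of _≡_[mod_]: unlike the unfolded divisibility ∣ a - b ∣,
-- its indices can be inferred by unification.
record _≋_[mod_] (a b : ℤ) (N : ℕ) : Set where
  constructor wrap
  field unwrap : a ≡ b [mod N ]
open _≋_[mod_]

infix 4 _≋_[mod_]

≋-via : ∀ {N a b e} → a - b ≡ e → + N ∣ e → a ≋ b [mod N ]
≋-via {N} a-b≡e N∣e = wrap (∣⇒∣ᵤ (subst (+ N ∣_) (sym a-b≡e) N∣e))

∣_⟨≋⟩ : ∀ {N a b} → a ≋ b [mod N ] → + N ∣ a - b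
∣ a≋b ⟨≋⟩ = ∣ᵤ⇒∣ (unwrap a≋b)

≡⇒≋ : ∀ {N a b} → a ≡ b → a ≋ b [mod N ]
≡⇒≋ {a = a} refl = ≋-via (ℤ.+-inverseʳ a) (divides 0ℤ refl)

≋-sym : ∀ {N a b} → a ≋ b [mod N ] → b ≋ a [mod N ]
≋-sym {N} {a} {b} (wrap a≡b) = wrap (subst (N ℕ.∣_) (ℤ.∣i-j∣≡∣j-i∣ a b) a≡b)

≋-trans : ∀ {N a b c} → a ≋ b [mod N ] → b ≋ c [mod N ] → a ≋ c [mod N ]
≋-trans {a = a} {b} {c} a≋b b≋c =
  ≋-via (telescope a b c) (∣m∣n⇒∣m+n ∣ a≋b ⟨≋⟩ ∣ b≋c ⟨≋⟩)
  where
  telescope : ∀ a b c → a - c ≡ (a - b) + (b - c)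
  telescope = solve-∀

+-cong-≋ : ∀ {N a b c d} → a ≋ b [mod N ] → c ≋ d [mod N ] → a + c ≋ b + d [mod N ]
+-cong-≋ {a = a} {b} {c} {d} a≋b c≋d =
  ≋-via (regroup a b c d) (∣m∣n⇒∣m+n ∣ a≋b ⟨≋⟩ ∣ c≋d ⟨≋⟩)
  where
  regroup : ∀ a b c d → (a + c) - (b + d) ≡ (a - b) + (c - d)
  regroup = solve-∀

*-congˡ-≋ : ∀ {N a b} c → a ≋ b [mod N ] → c * a ≋ c * b [mod N ]
*-congˡ-≋ {a = a} {b} c a≋b = ≋-via (distrib c a b) (∣n⇒∣m*n c ∣ a≋b ⟨≋⟩)
  where
  distrib : ∀ c a b → c * a - c * b ≡ c * (a - b)
  distrib = solve-∀

1≋0⇒≡1 : ∀ {N} → 1ℤ ≋ 0ℤ [mod N ] → N ≡ 1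
1≋0⇒≡1 (wrap N∣1) = ℕ.∣1⇒≡1 N∣1

Σ-cong-≋ : ∀ {N} k {f g : Fin k → ℤ} → (∀ i → f i ≋ g i [mod N ]) → Σ k f ≋ Σ k g [mod N ]
Σ-cong-≋ ℕ.zero    f≋g = ≡⇒≋ refl
Σ-cong-≋ (ℕ.suc k) f≋g = +-cong-≋ (f≋g zero) (Σ-cong-≋ k (λ i → f≋g (suc i)))

*-pres-∣ : ∀ {M K a b} → + M ∣ a → + K ∣ b → + (M ℕ.* K) ∣ a * b
*-pres-∣ {M} {K} (divides q refl) (divides r refl) =
  divides (q * r) (trans (regroup q (+ M) r (+ K)) (cong (q * r *_) (sym (ℤ.pos-* M K))))
  where
  regroup : ∀ q M r K → (q * M) * (r * K) ≡ (q * r) * (M * K)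
  regroup = solve-∀

+-multiple-≋ : ∀ {N} a b → a + + N * b ≋ a [mod N ]
+-multiple-≋ {N} a b = ≋-via (cancel a (+ N) b) (∣n⇒∣m*n b (∣-refl {+ N}))
  where
  cancel : ∀ a N b → (a + N * b) - a ≡ b * N
  cancel = solve-∀

∣⇒≋0 : ∀ {N a} → N ℕ.∣ ∣ a ∣ → a ≋ 0ℤ [mod N ]
∣⇒≋0 {N} {a} N∣a = wrap (subst (N ℕ.∣_) (cong ∣_∣ (sym (ℤ.+-identityʳ a))) N∣a)

combination-≋ : ∀ {N k v} (p : Primitive N k v) → Σ k (λ i → proj₁ p i * v i) ≋ 1ℤ [mod N ]
combination-≋ (c , cv≡1) = wrap cv≡1

≋⇒Primitive : ∀ {N k v} c → Σ k (λ i → c i * v i) ≋ 1ℤ [mod N ] → Primitive N k v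
≋⇒Primitive c cv≋1 = c , unwrap cv≋1

Primitive-resp-≋ : ∀ {K k v w} → (∀ i → v i ≋ w i [mod K ]) → Primitive K k v → Primitive K k w
Primitive-resp-≋ {k = k} v≋w p@(c , _) =
  ≋⇒Primitive c (≋-trans (Σ-cong-≋ k (λ i → *-congˡ-≋ (c i) (≋-sym (v≋w i)))) (combination-≋ p))

Primitive-resp : ∀ {K k v w} → (∀ i → v i ≡ w i) → Primitive K k v → Primitive K k w
Primitive-resp v≡w = Primitive-resp-≋ (λ i → ≡⇒≋ (v≡w i))

Primitive-weaken : ∀ {K M k v} → K ℕ.∣ M → Primitive M k v → Primitive K k v
Primitive-weaken K∣M (c , cv≡1) = c , ℕ.∣-trans K∣M cv≡1

Primitive[1] : ∀ {k v} → Primitive 1 k v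
Primitive[1] = (λ _ → 0ℤ) , ℕ.1∣ _

Primitive-zero⇒≡1 : ∀ {K k} → Primitive K k (λ _ → 0ℤ) → K ≡ 1
Primitive-zero⇒≡1 {k = k} p@(c , _) = 1≋0⇒≡1 (≋-sym (≋-trans (≡⇒≋ (sym Σc0≡0)) (combination-≋ p)))
  where
  Σc0≡0 : Σ k (λ i → c i * 0ℤ) ≡ 0ℤ
  Σc0≡0 = trans (Σ-cong k (λ i → ℤ.*-zeroʳ (c i))) (Σ-zero k)

Primitive-invertible-entry : ∀ {K k v} i → (∃ λ u → u * v i ≋ 1ℤ [mod K ]) → Primitive K k v
Primitive-invertible-entry {k = k} {v} i (u , uv≋1) =
  ≋⇒Primitive (λ j → u * δ i j) (≋-trans (≡⇒≋ pick) uv≋1)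
  where
  pick : Σ k (λ j → (u * δ i j) * v j) ≡ u * v i
  pick = trans (Σ-cong k (λ j → rearrange u (δ i j) (v j))) (Σ-δ k i (λ j → u * v j))
    where
    rearrange : ∀ u d x → (u * d) * x ≡ d * (u * x)
    rearrange = solve-∀

Primitive-scale : ∀ {K k v} a → (∃ λ u → u * a ≋ 1ℤ [mod K ]) → Primitive K k v →
                  Primitive K k (λ i → a * v i)
Primitive-scale {k = k} {v} a (u , ua≋1) p@(c , _) =
  ≋⇒Primitive (λ i → u * c i) (≋-trans (Σ-cong-≋ k cancel) (combination-≋ p))
  where
  rearrange : ∀ u c a x → (u * c) * (a * x) ≡ (c * x) * (u * a)
  rearrange = solve-∀
  cancel : ∀ i → (u * c i) * (a * v i) ≋ c i * v i [mod _ ]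
  cancel i = ≋-trans (≡⇒≋ (rearrange u (c i) a (v i)))
             (≋-trans (*-congˡ-≋ (c i * v i) ua≋1) (≡⇒≋ (ℤ.*-identityʳ (c i * v i))))

-- If S ≡ 1 mod M and T ≡ 1 mod K then S + (1 - S) T - 1 = -(S - 1)(T - 1) ≡ 0 mod M K.
Primitive-* : ∀ {M K k v} → Primitive M k v → Primitive K k v → Primitive (M ℕ.* K) k v
Primitive-* {M} {K} {k} {v} p@(c , _) q@(d , _) =
  ≋⇒Primitive (λ i → c i + (1ℤ - S) * d i)
              (≋-via eq (∣m⇒∣-m (*-pres-∣ ∣ combination-≋ p ⟨≋⟩ ∣ combination-≋ q ⟨≋⟩)))
  where
  S = Σ k (λ i → c i * v i)
  T = Σ k (λ i → d i * v i)
  distrib : ∀ c t d x → (c + t * d) * x ≡ c * x + t * (d * x)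
  distrib = solve-∀
  combine : ∀ S T → (S + (1ℤ - S) * T) - 1ℤ ≡ - ((S - 1ℤ) * (T - 1ℤ))
  combine = solve-∀
  eq : Σ k (λ i → (c i + (1ℤ - S) * d i) * v i) - 1ℤ ≡ - ((S - 1ℤ) * (T - 1ℤ))
  eq = begin
    Σ k (λ i → (c i + (1ℤ - S) * d i) * v i) - 1ℤ
      ≡⟨ cong (_- 1ℤ) (Σ-cong k (λ i → distrib (c i) (1ℤ - S) (d i) (v i))) ⟩
    Σ k (λ i → c i * v i + (1ℤ - S) * (d i * v i)) - 1ℤ
      ≡⟨ cong (_- 1ℤ) (Σ-linear k (1ℤ - S) _ _) ⟩
    (S + (1ℤ - S) * T) - 1ℤ
      ≡⟨ combine S T ⟩
    - ((S - 1ℤ) * (T - 1ℤ)) ∎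

pos-1+*≡* : ∀ a b c d → 1 ℕ.+ a ℕ.* b ≡ c ℕ.* d → 1ℤ + + a * + b ≡ + c * + d
pos-1+*≡* a b c d eq = begin
  1ℤ + + a * + b     ≡⟨ cong (_+_ 1ℤ) (sym (ℤ.pos-* a b)) ⟩
  + (1 ℕ.+ a ℕ.* b)  ≡⟨ cong +_ eq ⟩
  + (c ℕ.* d)        ≡⟨ ℤ.pos-* c d ⟩
  + c * + d          ∎

prime⇒≢1 : ∀ {p} → Prime p → ¬ p ≡ 1
prime⇒≢1 pr refl = ¬prime[1] pr

prime∤⇒coprime : ∀ {p a} → Prime p → ¬ p ℕ.∣ a → Coprime a p
prime∤⇒coprime pr p∤a {d} (d∣a , d∣p) with prime⇒irreducible pr d∣p
... | inj₁ d≡1 = d≡1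
... | inj₂ refl = contradiction d∣a p∤a

coprime⇒invertible : ∀ {a q} → Coprime a q → ∃ λ u → u * + a ≋ 1ℤ [mod q ]
coprime⇒invertible {a} {q} a⊥q with coprime-Bézout a⊥q
... | Bézout.+- x y 1+yq≡xa =
  + x , ≋-via (shift (+ x) (+ a) (+ y) (+ q) (pos-1+*≡* y q x a 1+yq≡xa)) (∣n⇒∣m*n (+ y) ∣-refl)
  where
  shift : ∀ x a y q → 1ℤ + y * q ≡ x * a → x * a - 1ℤ ≡ y * q
  shift x a y q eq = trans (cong (_- 1ℤ) (sym eq)) (cancel y q)
    where
    cancel : ∀ y q → (1ℤ + y * q) - 1ℤ ≡ y * q
    cancel = solve-∀
... | Bézout.-+ x y 1+xa≡yq =
  - + x , ≋-via (shift (+ x) (+ a) (+ y) (+ q) (pos-1+*≡* x a y q 1+xa≡yq)) (∣n⇒∣m*n (- + y) ∣-refl)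
  where
  shift : ∀ x a y q → 1ℤ + x * a ≡ y * q → (- x) * a - 1ℤ ≡ (- y) * q
  shift x a y q eq = trans (negate x a) (trans (cong -_ eq) (ℤ.neg-distribˡ-* y q))
    where
    negate : ∀ x a → (- x) * a - 1ℤ ≡ - (1ℤ + x * a)
    negate = solve-∀

invertible-mod-prime : ∀ {q} a → Prime q → ¬ q ℕ.∣ ∣ a ∣ → ∃ λ u → u * a ≋ 1ℤ [mod q ]
invertible-mod-prime (+ n)    pr q∤a = coprime⇒invertible (prime∤⇒coprime pr q∤a)
invertible-mod-prime -[1+ n ] pr q∤a with coprime⇒invertible (prime∤⇒coprime pr q∤a)
... | u , u*a≋1 = - u , ≋-trans (≡⇒≋ (neg-neg u (+ ℕ.suc n))) u*a≋1
  where
  neg-neg : ∀ u a → (- u) * (- a) ≡ u * a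
  neg-neg = solve-∀

primitive-or-zero-mod-prime : ∀ {q k} → Prime q → (v : Fin k → ℤ) →
                              Primitive q k v ⊎ (∀ i → v i ≋ 0ℤ [mod q ])
primitive-or-zero-mod-prime {q} pr v with Fin.any? (λ i → ¬? (q ℕ.∣? ∣ v i ∣))
... | yes (i , q∤vi) = inj₁ (Primitive-invertible-entry i (invertible-mod-prime (v i) pr q∤vi))
... | no ∄i          =
  inj₂ (λ i → ∣⇒≋0 (decidable-stable (q ℕ.∣? ∣ v i ∣) (λ q∤vi → ∄i (i , q∤vi))))

zero-mod-prime⇒¬Primitive : ∀ {q k v} → Prime q → (∀ i → v i ≋ 0ℤ [mod q ]) → ¬ Primitive q k v
zero-mod-prime⇒¬Primitive pr v≋0 prim = prime⇒≢1 pr (Primitive-zero⇒≡1 (Primitive-resp-≋ v≋0 prim))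

-- If w is already primitive mod q, take t = 0.  Otherwise w ≡ 0 mod q, which forces q ∤ P,
-- and t = P keeps w + t v ≡ w mod P while making it ≡ P v, a unit multiple of v, mod q.
Primitive-extend-mod-prime : ∀ {q P k w v} → Prime q → Primitive P k w → Primitive q k v →
                             ∃ λ t → Primitive (q ℕ.* P) k (λ i → w i + t * v i)
Primitive-extend-mod-prime {q} {P} {k} {w} {v} pr w-prim v-prim
  with primitive-or-zero-mod-prime pr w
... | inj₁ w-prim-q =
  0ℤ , Primitive-resp (λ i → sym (drop (w i) (v i))) (Primitive-* w-prim-q w-prim)
  where
  drop : ∀ a b → a + 0ℤ * b ≡ a
  drop = solve-∀
... | inj₂ w≋0 =
  + P , Primitive-* Pv-prim-q (Primitive-resp-≋ (λ i → ≋-sym (+-multiple-≋ (w i) (v i))) w-prim)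
  where
  q∤P : ¬ q ℕ.∣ P
  q∤P q∣P = zero-mod-prime⇒¬Primitive pr w≋0 (Primitive-weaken q∣P w-prim)
  w+Pv≋Pv : ∀ i → + P * v i ≋ w i + + P * v i [mod q ]
  w+Pv≋Pv i =
    ≋-sym (≋-trans (+-cong-≋ (w≋0 i) (≡⇒≋ refl)) (≡⇒≋ (ℤ.+-identityˡ (+ P * v i))))
  Pv-prim-q : Primitive q k (λ i → w i + + P * v i)
  Pv-prim-q = Primitive-resp-≋ w+Pv≋Pv
                (Primitive-scale (+ P) (invertible-mod-prime (+ P) pr q∤P) v-prim)

colComb-δ : ∀ n m (A : Fin n → Fin m → ℤ) j i → colComb n m A (δ j) i ≡ A i j
colComb-δ n m A j i = Σ-δ m j (A i)

colComb-linear : ∀ n m (A : Fin n → Fin m → ℤ) x t y i →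
                 colComb n m A (λ j → x j + t * y j) i ≡ colComb n m A x i + t * colComb n m A y i
colComb-linear n m A x t y i =
  trans (Σ-cong m (λ j → distrib (x j) t (y j) (A i j))) (Σ-linear m t _ _)
  where
  distrib : ∀ x t y a → (x + t * y) * a ≡ x * a + t * (y * a)
  distrib = solve-∀

PrimitiveEntries-weaken : ∀ {K M n m A} → K ℕ.∣ M →
                          PrimitiveEntries M n m A → PrimitiveEntries K n m A
PrimitiveEntries-weaken K∣M (c , cA≡1) = c , ℕ.∣-trans K∣M cA≡1

primitive-colComb-mod-prime : ∀ {q n m A} → Prime q → PrimitiveEntries q n m A →
                              ∃ λ y → Primitive q n (colComb n m A y)
primitive-colComb-mod-prime {q} {n} {m} {A} pr (c , cA≡1)
  with Fin.any? (λ i → Fin.any? (λ j → ¬? (q ℕ.∣? ∣ A i j ∣)))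
... | yes (i , j , q∤Aij) =
  δ j , Primitive-resp (λ i′ → sym (colComb-δ n m A j i′))
                       (Primitive-invertible-entry i (invertible-mod-prime (A i j) pr q∤Aij))
... | no ∄ij = contradiction (1≋0⇒≡1 (≋-trans (≋-sym cA≋1) cA≋0)) (prime⇒≢1 pr)
  where
  A≋0 : ∀ i j → A i j ≋ 0ℤ [mod q ]
  A≋0 i j = ∣⇒≋0 (decidable-stable (q ℕ.∣? ∣ A i j ∣) (λ q∤Aij → ∄ij (i , j , q∤Aij)))
  cA≋1 : Σ n (λ i → Σ m (λ j → c i j * A i j)) ≋ 1ℤ [mod q ]
  cA≋1 = wrap cA≡1
  c0≡0 : Σ n (λ i → Σ m (λ j → c i j * 0ℤ)) ≡ 0ℤ
  c0≡0 = trans (Σ-cong n (λ i → trans (Σ-cong m (λ j → ℤ.*-zeroʳ (c i j))) (Σ-zero m)))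
               (Σ-zero n)
  cA≋0 : Σ n (λ i → Σ m (λ j → c i j * A i j)) ≋ 0ℤ [mod q ]
  cA≋0 = ≋-trans (Σ-cong-≋ n (λ i → Σ-cong-≋ m (λ j → *-congˡ-≋ (c i j) (A≋0 i j)))) (≡⇒≋ c0≡0)

primitive-colComb-mod-product : ∀ {n m} (A : Fin n → Fin m → ℤ) (L : List ℕ) →
  All (λ q → Prime q × ∃ λ y → Primitive q n (colComb n m A y)) L →
  ∃ λ x → Primitive (product L) n (colComb n m A x)
primitive-colComb-mod-product A []      []                         = (λ _ → 0ℤ) , Primitive[1]
primitive-colComb-mod-product {n} {m} A (q ∷ L) ((pr , y , y-prim) ∷ rest)
  with primitive-colComb-mod-product A L rest
... | x , x-prim with Primitive-extend-mod-prime pr x-prim y-prim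
... | t , prim =
  (λ j → x j + t * y j) , Primitive-resp (λ i → sym (colComb-linear n m A x t y i)) prim

lemma3p1 : (N : ℕ) → 2 ≤ N → (n m : ℕ) → (A : Fin n → Fin m → ℤ) →
    PrimitiveEntries N n m A →
    ∃ λ (x : Fin m → ℤ) → Primitive N n (colComb n m A x)
lemma3p1 N@(suc _) _ n m A entries =
  subst (λ K → ∃ λ x → Primitive K n (colComb n m A x)) (sym isFactorisation)
        (primitive-colComb-mod-product A factors (All.tabulate local))
  where
  open PrimeFactorisation (factorise N)
  local : ∀ {q} → q ∈ factors → Prime q × ∃ λ y → Primitive q n (colComb n m A y)
  local {q} q∈ = pr , primitive-colComb-mod-prime pr (PrimitiveEntries-weaken q∣N entries)
    where
    pr : Prime q
    pr = All.lookup factorsPrime q∈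
    q∣N : q ℕ.∣ N
    q∣N = subst (q ℕ.∣_) (sym isFactorisation) (∈⇒∣product q∈)
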